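{- Let $\lambda$ be a partition, $v\in B_n\lambda$, and let $T$ be the tableau obtained by adjoining the column with entries $1,2,\dots,n$ (top to bottom) to the left of $K(v)$. Read $T$ column by column from right to left, each column from top to bottom, and keep only the first occurrence of each absolute value. The resulting sequence $\alpha_1\cdots\alpha_n$ is the window notation $[\alpha_1\cdots\alpha_n]$ of the minimal length element $\sigma\in B_n$ with $\sigma\lambda=v$.
   Context: $[\pm n]=\{1,\dots,n,\overline n,\dots,\overline1\}$ ($\overline i=-i$), ordered $1<\dots<n<\overline n<\dots<\overline1$. $B_n$ is the group of bijections $\sigma$ of $[\pm n]$ with $\sigma(\overline i)=\overline{\sigma(i)}$, with window notation $[\sigma(1)\cdots\sigma(n)]$; it is a Coxeter group generated by $s_1,\dots,s_n$ (right multiplication by $s_i$, $i<n$, swaps window positions $i,i+1$; by $s_n$ negates the last window entry), and length means minimal number of generators. It acts on $\mathbb Z^n$ by $\sigma v=(\mathrm{sgn}(\sigma^{ -1}(j))v_{|\sigma^{ -1}(j)|})_{j=1}^n$. A partition is $\lambda=(\lambda_1\ge\dots\ge\lambda_n\ge0)$. A key tableau is a semistandard tableau of partition shape with entries in $[\pm n]$ such that the entry set of each column contains that of the next column to its right and no $i$ has both $i,\overline i$ as entries; $K(v)$ is the unique key tableau of weight $v$ (weight: number of $i$'s minus number of $\overline i$'s). -}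

module Defs where

open import Data.Nat as ℕ using (ℕ; zero; suc; _<ᵇ_)
open import Data.Integer as ℤ using (ℤ; +_; -_; _-_)
open import Data.Fin as Fin using (Fin; toℕ)
open import Data.Fin.Properties as FinP using ()
open import Data.Vec as Vec using (Vec; []; _∷_; lookup)
open import Data.List as List using (List; []; _∷_; length; filter; concat; reverse; deduplicate)
open import Data.List.Membership.Propositional using (_∈_)
open import Data.List.Relation.Unary.Linked using (Linked)
open import Data.List.Relation.Unary.All using (All)
open import Data.Bool using (if_then_else_)
open import Data.Product using (Σ; _×_; ∃)
open import Data.Sum using (_⊎_)
open import Data.Unit using (⊤)
open import Data.Empty using (⊥)
open import Relation.Binary.PropositionalEquality using (_≡_; refl; cong)
open import Relation.Binary.Definitions using (DecidableEquality)
open import Relation.Nullary using (yes; no; ¬_)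

-- [±n] : pos i stands for i+1, neg i for the barred letter ‾(i+1)

data SFin (n : ℕ) : Set where
  pos : Fin n → SFin n
  neg : Fin n → SFin n

absS : ∀ {n} → SFin n → Fin n
absS (pos i) = i
absS (neg i) = i

negS : ∀ {n} → SFin n → SFin n
negS (pos i) = neg i
negS (neg i) = pos i

signApply : ∀ {n} → SFin n → ℤ → ℤ
signApply (pos _) z = z
signApply (neg _) z = - z

_≟S_ : ∀ {n} → DecidableEquality (SFin n)
pos i ≟S pos j with i Fin.≟ j
... | yes refl = yes refl
... | no ¬p = no λ { refl → ¬p refl }
pos i ≟S neg j = no λ ()
neg i ≟S pos j = no λ ()
neg i ≟S neg j with i Fin.≟ j
... | yes refl = yes refl
... | no ¬p = no λ { refl → ¬p refl }

-- the order 1 < ... < n < ‾n < ... < ‾1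
data _<S_ {n : ℕ} : SFin n → SFin n → Set where
  pos<pos : ∀ {i j} → i Fin.< j → pos i <S pos j
  pos<neg : ∀ {i j} → pos i <S neg j
  neg<neg : ∀ {i j} → j Fin.< i → neg i <S neg j

_≤S_ : ∀ {n} → SFin n → SFin n → Set
x ≤S y = x <S y ⊎ x ≡ y

Window : ℕ → Set
Window n = Vec (SFin n) n

IsSignedPerm : ∀ {n} → Window n → Set
IsSignedPerm {n} σ = ∀ (i j : Fin n) → absS (lookup σ i) ≡ absS (lookup σ j) → i ≡ j

idWindow : ∀ n → Window n
idWindow n = Vec.map pos (Vec.allFin n)

swapAt : ∀ {A : Set} {m} → ℕ → Vec A m → Vec A m
swapAt zero (x ∷ y ∷ xs) = y ∷ x ∷ xs
swapAt (suc k) (x ∷ xs) = x ∷ swapAt k xs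
swapAt _ xs = xs

negLast : ∀ {n m} → Vec (SFin n) m → Vec (SFin n) m
negLast [] = []
negLast (x ∷ []) = negS x ∷ []
negLast (x ∷ y ∷ xs) = x ∷ negLast (y ∷ xs)

-- right multiplication by the generator s_{k+1} (k : Fin n, 0-indexed):
-- for k+1 < n it swaps window positions k+1, k+2; for k+1 = n it is s_n.
rmulGen : ∀ {n} → Window n → Fin n → Window n
rmulGen {n} σ k = if suc (toℕ k) <ᵇ n then swapAt (toℕ k) σ else negLast σ

Word : ℕ → Set
Word n = List (Fin n)

evalWord : ∀ {n} → Word n → Window n
evalWord {n} w = List.foldl rmulGen (idWindow n) w

-- ℓ(σ) ≤ ℓ(τ), with ℓ = minimal number of generators
LengthLE : ∀ {n} → Window n → Window n → Set
LengthLE {n} σ τ =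
  Σ (Word n) λ w → evalWord w ≡ σ ×
    (∀ (w' : Word n) → evalWord w' ≡ τ → length w ℕ.≤ length w')

-- action of B_n on ℤ^n:  (σ u)_j = sgn(σ⁻¹(j)) u_{|σ⁻¹(j)|},
-- i.e. (σ u)_{|σ(i)|} = sgn(σ(i)) u_i  (σ is a bijection).
ActsTo : ∀ {n} → Window n → Vec ℤ n → Vec ℤ n → Set
ActsTo {n} σ u v = ∀ (i : Fin n) → lookup v (absS (lookup σ i)) ≡ signApply (lookup σ i) (lookup u i)

IsPartition : ∀ {n} → Vec ℕ n → Set
IsPartition {n} λ' = ∀ (i j : Fin n) → i Fin.≤ j → lookup λ' j ℕ.≤ lookup λ' i

toℤVec : ∀ {n} → Vec ℕ n → Vec ℤ n
toℤVec = Vec.map +_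

InOrbit : ∀ {n} → Vec ℤ n → Vec ℕ n → Set
InOrbit {n} v λ' = Σ (Window n) λ σ → IsSignedPerm σ × ActsTo σ (toℤVec λ') v

-- tableaux: a list of columns, left to right; each column listed top to bottom

Column : ℕ → Set
Column n = List (SFin n)

Tableau : ℕ → Set
Tableau n = List (Column n)

-- row condition between a column and the column to its right
-- (also forces the right column to be no longer than the left one)
RowWeak : ∀ {n} → Column n → Column n → Set
RowWeak _ [] = ⊤
RowWeak [] (_ ∷ _) = ⊥
RowWeak (x ∷ xs) (y ∷ ys) = x ≤S y × RowWeak xs ys

NonEmpty : ∀ {A : Set} → List A → Set
NonEmpty [] = ⊥
NonEmpty (_ ∷ _) = ⊤

IsSSYT : ∀ {n} → Tableau n → Set
IsSSYT T = All NonEmpty T × All (Linked _<S_) T × Linked RowWeak T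

entries : ∀ {n} → Tableau n → List (SFin n)
entries = concat

IsKeyTableau : ∀ {n} → Tableau n → Set
IsKeyTableau {n} T =
  IsSSYT T ×
  Linked (λ c c' → ∀ x → x ∈ c' → x ∈ c) T ×
  (∀ (i : Fin n) → pos i ∈ entries T → neg i ∈ entries T → ⊥)

count : ∀ {n} → SFin n → List (SFin n) → ℕ
count x xs = length (filter (x ≟S_) xs)

weight : ∀ {n} → Tableau n → Vec ℤ n
weight {n} T = Vec.tabulate λ i → (+ count (pos i) (entries T)) - (+ count (neg i) (entries T))

adjoinIdColumn : ∀ {n} → Tableau n → Tableau n
adjoinIdColumn {n} T = List.map pos (List.allFin n) ∷ T

readingWord : ∀ {n} → Tableau n → List (SFin n)
readingWord T = deduplicate (λ x y → absS x Fin.≟ absS y) (concat (reverse T))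

-- The type B inversion number lengthB of a window is its Coxeter length: right multiplication by a
-- generator changes it by at most one, and lowers it by exactly one at a descent.  Generators fixing λ
-- preserve σλ = v, so removing descents of this kind reduces any τ with τλ = v, without increasing its
-- length, to a σ without them.  The window of such a σ contains every absolute value once, signed like the
-- corresponding entry of v (0 counting as positive), ordered by decreasing |v| and then by the order of
-- [±n]; so σ does not depend on τ and has minimal length.  The reading word has the same description: a
-- letter x occurs in exactly the first |v(|x|)| of the nested columns of K(v), so reading right to left
-- meets the letters by decreasing |v(|x|)|, and within a column in increasing order.  The case v = λ = 0,
-- where σ is the identity, provides words of length lengthB.  Finally K(v) exists: its k-th column consists
-- of the letters ±a, signed like v(a), with |v(a)| ≥ k.

module Submission where

open import Defs
open import Data.Bool.Base using (true; false; if_then_else_; T)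
open import Data.Empty using (⊥; ⊥-elim)
open import Data.Fin.Base as Fin using (Fin; toℕ; fromℕ; fromℕ<)
import Data.Fin.Properties as Finₚ
open import Data.Integer.Base as ℤ using (ℤ; -[1+_])
import Data.Integer.Properties as ℤₚ
open import Data.List.Base as List using (List; []; _∷_; _++_; [_]; length; filter; concat; reverse; deduplicate)
import Data.List.Properties as Listₚ
open import Data.List.Membership.Propositional using (_∈_; find)
import Data.List.Membership.Propositional.Properties as ∈ₚ
open import Data.List.Relation.Binary.Pointwise using (Pointwise; []; _∷_)
open import Data.List.Relation.Binary.Sublist.Propositional using (_⊆_; []; _∷_; _∷ʳ_; ⊆-refl; ⊆-trans; to∈)
import Data.List.Relation.Binary.Sublist.Propositional.Properties as Sublistₚ
open import Data.List.Relation.Unary.All as All using (All; []; _∷_)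
import Data.List.Relation.Unary.All.Properties as Allₚ
open import Data.List.Relation.Unary.AllPairs as AllPairs using (AllPairs; []; _∷_)
import Data.List.Relation.Unary.AllPairs.Properties as AllPairsₚ
open import Data.List.Relation.Unary.Any as Any using (Any; here; there)
import Data.List.Relation.Unary.Any.Properties as Anyₚ
open import Data.List.Relation.Unary.Unique.Propositional using (Unique)
open import Data.List.Relation.Unary.Linked as Linked using (Linked; []; [-]; _∷_)
import Data.List.Relation.Unary.Linked.Properties as Linkedₚ
open import Data.Nat.Base as ℕ using (ℕ; zero; suc; _+_; _∸_; _≤_; _<_; z≤n; s≤s)
open import Data.Nat.Induction using (<-wellFounded)
open import Data.Nat.ListAction using (sum)
import Data.Nat.Properties as ℕₚ
open import Data.Nat.Tactic.RingSolver using (solve-∀)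
open import Data.Product using (Σ; ∃; _×_; _,_; proj₁; proj₂)
open import Data.Sum using (_⊎_; inj₁; inj₂)
open import Data.Unit using (tt)
open import Data.Vec.Base as Vec using (Vec; []; _∷_; lookup; toList)
import Data.Vec.Membership.Propositional.Properties as Vec∈ₚ
import Data.Vec.Properties as Vecₚ
import Data.Vec.Relation.Unary.All.Properties as VecAllₚ
open import Function.Base using (_∘_; case_of_)
open import Induction.WellFounded using (Acc; acc)
open import Relation.Binary.Consequences using (tri⇒dec<)
open import Relation.Binary.Definitions using (Asymmetric; Decidable; Trichotomous; Tri; tri<; tri≈; tri>)
open import Relation.Binary.PropositionalEquality
  using (_≡_; _≢_; refl; sym; trans; cong; cong₂; subst; subst₂; module ≡-Reasoning)
open import Relation.Nullary using (Dec; yes; no; ¬_; ¬?; does; _×-dec_)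

private
  variable
    n : ℕ

<S-irrefl : {x : SFin n} → ¬ x <S x
<S-irrefl (pos<pos p) = Finₚ.<-irrefl refl p
<S-irrefl (neg<neg p) = Finₚ.<-irrefl refl p

<S-trans : {x y z : SFin n} → x <S y → y <S z → x <S z
<S-trans (pos<pos p) (pos<pos q) = pos<pos (Finₚ.<-trans p q)
<S-trans (pos<pos p) pos<neg = pos<neg
<S-trans pos<neg (neg<neg q) = pos<neg
<S-trans (neg<neg p) (neg<neg q) = neg<neg (Finₚ.<-trans q p)

<S-asym : Asymmetric (_<S_ {n})
<S-asym p q = <S-irrefl (<S-trans p q)

private
  tri-< : {x y : SFin n} → x <S y → Tri (x <S y) (x ≡ y) (y <S x)
  tri-< p = tri< p (λ { refl → <S-irrefl p }) (<S-asym p)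

  tri-> : {x y : SFin n} → y <S x → Tri (x <S y) (x ≡ y) (y <S x)
  tri-> p = tri> (<S-asym p) (λ { refl → <S-irrefl p }) p

  tri-≡ : {x : SFin n} → Tri (x <S x) (x ≡ x) (x <S x)
  tri-≡ = tri≈ <S-irrefl refl <S-irrefl

<S-cmp : Trichotomous _≡_ (_<S_ {n})
<S-cmp (pos i) (pos j) with Finₚ.<-cmp i j
... | tri< i<j _ _ = tri-< (pos<pos i<j)
... | tri≈ _ refl _ = tri-≡
... | tri> _ _ j<i = tri-> (pos<pos j<i)
<S-cmp (pos i) (neg j) = tri-< pos<neg
<S-cmp (neg i) (pos j) = tri-> pos<neg
<S-cmp (neg i) (neg j) with Finₚ.<-cmp i j
... | tri< i<j _ _ = tri-> (neg<neg i<j)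
... | tri≈ _ refl _ = tri-≡
... | tri> _ _ j<i = tri-< (neg<neg j<i)

_<S?_ : Decidable (_<S_ {n})
_<S?_ = tri⇒dec< <S-cmp

≯∧≢⇒<S : {x y : SFin n} → ¬ y <S x → x ≢ y → x <S y
≯∧≢⇒<S {x = x} {y} y≮x x≢y with <S-cmp x y
... | tri< x<y _ _ = x<y
... | tri≈ _ x≡y _ = ⊥-elim (x≢y x≡y)
... | tri> _ _ y<x = ⊥-elim (y≮x y<x)

negS-involutive : (x : SFin n) → negS (negS x) ≡ x
negS-involutive (pos _) = refl
negS-involutive (neg _) = refl

negS-antimono : {x y : SFin n} → x <S y → negS y <S negS x
negS-antimono (pos<pos p) = neg<neg p
negS-antimono pos<neg = pos<neg
negS-antimono (neg<neg p) = pos<pos p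

absS-negS : (x : SFin n) → absS (negS x) ≡ absS x
absS-negS (pos _) = refl
absS-negS (neg _) = refl

⟦_<S_⟧ : SFin n → SFin n → ℕ
⟦ x <S y ⟧ = if does (x <S? y) then 1 else 0

⟦<S⟧-yes : {x y : SFin n} → x <S y → ⟦ x <S y ⟧ ≡ 1
⟦<S⟧-yes {x = x} {y} x<y with x <S? y
... | yes _ = refl
... | no x≮y = ⊥-elim (x≮y x<y)

⟦<S⟧-no : {x y : SFin n} → ¬ x <S y → ⟦ x <S y ⟧ ≡ 0
⟦<S⟧-no {x = x} {y} x≮y with x <S? y
... | yes x<y = ⊥-elim (x≮y x<y)
... | no _ = refl

⟦<S⟧≤1 : (x y : SFin n) → ⟦ x <S y ⟧ ≤ 1
⟦<S⟧≤1 x y with x <S? y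
... | yes _ = s≤s z≤n
... | no _ = z≤n

⟦negS<S⟧-comm : (x y : SFin n) → ⟦ negS x <S y ⟧ ≡ ⟦ negS y <S x ⟧
⟦negS<S⟧-comm x y with negS x <S? y | negS y <S? x
... | yes _ | yes _ = refl
... | no _ | no _ = refl
... | yes p | no q = ⊥-elim (q (subst (negS y <S_) (negS-involutive x) (negS-antimono p)))
... | no p | yes q = ⊥-elim (p (subst (negS x <S_) (negS-involutive y) (negS-antimono q)))

inversion : SFin n → SFin n → ℕ
inversion x y = ⟦ y <S x ⟧ + ⟦ negS y <S x ⟧

inversions : SFin n → List (SFin n) → ℕ
inversions x [] = 0
inversions x (y ∷ ys) = inversion x y + inversions x ys

barred : SFin n → ℕ
barred (pos _) = 0
barred (neg _) = 1

-- The type B inversion formula ℓ(w) = #{i<j : w i > w j} + #{i<j : w i > -w j} + #{i : w i barred},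
-- with comparisons in the order of [±n].
lengthB : List (SFin n) → ℕ
lengthB [] = 0
lengthB (x ∷ xs) = inversions x xs + barred x + lengthB xs

swapL : {A : Set} → ℕ → List A → List A
swapL zero (x ∷ y ∷ xs) = y ∷ x ∷ xs
swapL (suc k) (x ∷ xs) = x ∷ swapL k xs
swapL _ xs = xs

negLastL : List (SFin n) → List (SFin n)
negLastL [] = []
negLastL (x ∷ []) = negS x ∷ []
negLastL (x ∷ y ∷ xs) = x ∷ negLastL (y ∷ xs)

inversions-negS : (x y : SFin n) (ys : List (SFin n)) → inversions x (negS y ∷ ys) ≡ inversions x (y ∷ ys)
inversions-negS x y ys rewrite negS-involutive y =
  cong (_+ inversions x ys) (ℕₚ.+-comm ⟦ negS y <S x ⟧ ⟦ y <S x ⟧)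

inversions-swapL : (x : SFin n) (k : ℕ) (ys : List (SFin n)) → inversions x (swapL k ys) ≡ inversions x ys
inversions-swapL x zero [] = refl
inversions-swapL x zero (y ∷ []) = refl
inversions-swapL x zero (y ∷ z ∷ ys) = exchange (inversion x y) (inversion x z) (inversions x ys)
  where
  exchange : ∀ a b c → b + (a + c) ≡ a + (b + c)
  exchange = solve-∀
inversions-swapL x (suc k) [] = refl
inversions-swapL x (suc k) (y ∷ ys) = cong (inversion x y +_) (inversions-swapL x k ys)

inversions-negLastL : (x : SFin n) (ys : List (SFin n)) → inversions x (negLastL ys) ≡ inversions x ys
inversions-negLastL x [] = refl
inversions-negLastL x (y ∷ []) = inversions-negS x y []
inversions-negLastL x (y ∷ z ∷ ys) = cong (inversion x y +_) (inversions-negLastL x (z ∷ ys))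

lengthB-swap : (x y : SFin n) (xs : List (SFin n)) →
  lengthB (y ∷ x ∷ xs) + ⟦ y <S x ⟧ ≡ lengthB (x ∷ y ∷ xs) + ⟦ x <S y ⟧
lengthB-swap x y xs rewrite ⟦negS<S⟧-comm x y =
  shuffle ⟦ x <S y ⟧ ⟦ y <S x ⟧ ⟦ negS y <S x ⟧ (inversions y xs) (barred y) (inversions x xs) (barred x) (lengthB xs)
  where
  shuffle : ∀ a b c d e f g h → a + c + d + e + (f + g + h) + b ≡ b + c + f + g + (d + e + h) + a
  shuffle = solve-∀

lengthB-swapL≤ : (k : ℕ) (xs : List (SFin n)) → lengthB (swapL k xs) ≤ lengthB xs + 1
lengthB-swapL≤ zero [] = ℕₚ.m≤m+n _ 1
lengthB-swapL≤ zero (x ∷ []) = ℕₚ.m≤m+n _ 1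
lengthB-swapL≤ zero (x ∷ y ∷ xs) = begin
  lengthB (y ∷ x ∷ xs)                ≤⟨ ℕₚ.m≤m+n _ ⟦ y <S x ⟧ ⟩
  lengthB (y ∷ x ∷ xs) + ⟦ y <S x ⟧   ≡⟨ lengthB-swap x y xs ⟩
  lengthB (x ∷ y ∷ xs) + ⟦ x <S y ⟧   ≤⟨ ℕₚ.+-monoʳ-≤ (lengthB (x ∷ y ∷ xs)) (⟦<S⟧≤1 x y) ⟩
  lengthB (x ∷ y ∷ xs) + 1            ∎
  where open ℕₚ.≤-Reasoning
lengthB-swapL≤ (suc k) [] = ℕₚ.m≤m+n 0 1
lengthB-swapL≤ (suc k) (x ∷ xs) = begin
  inversions x (swapL k xs) + barred x + lengthB (swapL k xs)
    ≡⟨ cong (λ i → i + barred x + lengthB (swapL k xs)) (inversions-swapL x k xs) ⟩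
  inversions x xs + barred x + lengthB (swapL k xs)
    ≤⟨ ℕₚ.+-monoʳ-≤ (inversions x xs + barred x) (lengthB-swapL≤ k xs) ⟩
  inversions x xs + barred x + (lengthB xs + 1)
    ≡⟨ ℕₚ.+-assoc (inversions x xs + barred x) (lengthB xs) 1 ⟨
  inversions x xs + barred x + lengthB xs + 1 ∎
  where open ℕₚ.≤-Reasoning

lengthB-negLastL≤ : (xs : List (SFin n)) → lengthB (negLastL xs) ≤ lengthB xs + 1
lengthB-negLastL≤ [] = z≤n
lengthB-negLastL≤ (pos _ ∷ []) = s≤s z≤n
lengthB-negLastL≤ (neg _ ∷ []) = z≤n
lengthB-negLastL≤ (x ∷ y ∷ xs) = begin
  inversions x (negLastL (y ∷ xs)) + barred x + lengthB (negLastL (y ∷ xs))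
    ≡⟨ cong (λ i → i + barred x + lengthB (negLastL (y ∷ xs))) (inversions-negLastL x (y ∷ xs)) ⟩
  inversions x (y ∷ xs) + barred x + lengthB (negLastL (y ∷ xs))
    ≤⟨ ℕₚ.+-monoʳ-≤ (inversions x (y ∷ xs) + barred x) (lengthB-negLastL≤ (y ∷ xs)) ⟩
  inversions x (y ∷ xs) + barred x + (lengthB (y ∷ xs) + 1)
    ≡⟨ ℕₚ.+-assoc (inversions x (y ∷ xs) + barred x) (lengthB (y ∷ xs)) 1 ⟨
  inversions x (y ∷ xs) + barred x + lengthB (y ∷ xs) + 1 ∎
  where open ℕₚ.≤-Reasoning

-- A descent of xs whose generator fixes the weight vector cs: a swap of two adjacent entries over equal
-- entries of cs, or the sign change of a barred last entry over a last entry 0 of cs.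
data Descent {n : ℕ} : List ℕ → List (SFin n) → Set where
  swap   : ∀ {c cs x y xs} → y <S x → Descent (c ∷ c ∷ cs) (x ∷ y ∷ xs)
  negate : ∀ {i} → Descent (0 ∷ []) (neg i ∷ [])
  there  : ∀ {c cs x xs} → Descent cs xs → Descent (c ∷ cs) (x ∷ xs)

applyDescent : ∀ {cs} {xs : List (SFin n)} → Descent cs xs → List (SFin n)
applyDescent (swap {x = x} {y} {xs} _) = y ∷ x ∷ xs
applyDescent (negate {i}) = pos i ∷ []
applyDescent (there {x = x} d) = x ∷ applyDescent d

applyDescent-generator : ∀ {cs} {xs : List (SFin n)} (d : Descent cs xs) →
  (∃ λ j → suc j < length xs × applyDescent d ≡ swapL j xs) ⊎ applyDescent d ≡ negLastL xs
applyDescent-generator (swap _) = inj₁ (0 , s≤s (s≤s z≤n) , refl)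
applyDescent-generator negate = inj₂ refl
applyDescent-generator (there {x = x} {_ ∷ _} d) with applyDescent-generator d
... | inj₁ (j , j<len , eq) = inj₁ (suc j , s≤s j<len , cong (x ∷_) eq)
... | inj₂ eq = inj₂ (cong (x ∷_) eq)

inversions-applyDescent : ∀ (x : SFin n) {cs xs} (d : Descent cs xs) → inversions x (applyDescent d) ≡ inversions x xs
inversions-applyDescent x {xs = xs} d with applyDescent-generator d
... | inj₁ (j , _ , eq) rewrite eq = inversions-swapL x j xs
... | inj₂ eq rewrite eq = inversions-negLastL x xs

lengthB-applyDescent : ∀ {cs} {xs : List (SFin n)} (d : Descent cs xs) → suc (lengthB (applyDescent d)) ≤ lengthB xs
lengthB-applyDescent (swap {x = x} {y} {xs} y<x) = ℕₚ.≤-reflexive (begin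
  suc (lengthB (y ∷ x ∷ xs))            ≡⟨ ℕₚ.+-comm 1 _ ⟩
  lengthB (y ∷ x ∷ xs) + 1              ≡⟨ cong (lengthB (y ∷ x ∷ xs) +_) (⟦<S⟧-yes y<x) ⟨
  lengthB (y ∷ x ∷ xs) + ⟦ y <S x ⟧     ≡⟨ lengthB-swap x y xs ⟩
  lengthB (x ∷ y ∷ xs) + ⟦ x <S y ⟧     ≡⟨ cong (lengthB (x ∷ y ∷ xs) +_) (⟦<S⟧-no (<S-asym y<x)) ⟩
  lengthB (x ∷ y ∷ xs) + 0              ≡⟨ ℕₚ.+-identityʳ _ ⟩
  lengthB (x ∷ y ∷ xs)                  ∎)
  where open ≡-Reasoning
lengthB-applyDescent negate = s≤s z≤n
lengthB-applyDescent (there {x = x} {xs} d) = begin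
  suc (inversions x (applyDescent d) + barred x + lengthB (applyDescent d))
    ≡⟨ cong (λ i → suc (i + barred x + lengthB (applyDescent d))) (inversions-applyDescent x d) ⟩
  suc (inversions x xs + barred x + lengthB (applyDescent d))
    ≡⟨ ℕₚ.+-suc (inversions x xs + barred x) _ ⟨
  inversions x xs + barred x + suc (lengthB (applyDescent d))
    ≤⟨ ℕₚ.+-monoʳ-≤ (inversions x xs + barred x) (lengthB-applyDescent d) ⟩
  inversions x xs + barred x + lengthB xs ∎
  where open ℕₚ.≤-Reasoning

All-applyDescent : ∀ {P : SFin n → Set} → (∀ {y} → P y → P (negS y)) →
  ∀ {cs xs} (d : Descent cs xs) → All P xs → All P (applyDescent d)
All-applyDescent P-negS (swap _) (px ∷ py ∷ pxs) = py ∷ px ∷ pxs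
All-applyDescent P-negS negate (px ∷ []) = P-negS px ∷ []
All-applyDescent P-negS (there d) (px ∷ pxs) = px ∷ All-applyDescent P-negS d pxs

DistinctAbs : List (SFin n) → Set
DistinctAbs = AllPairs (λ x y → absS x ≢ absS y)

DistinctAbs-applyDescent : ∀ {cs xs} (d : Descent {n} cs xs) → DistinctAbs xs → DistinctAbs (applyDescent d)
DistinctAbs-applyDescent (swap _) ((x≢y ∷ x≢) ∷ (y≢ ∷ rest)) = ((x≢y ∘ sym) ∷ y≢) ∷ (x≢ ∷ rest)
DistinctAbs-applyDescent negate ([] ∷ []) = [] ∷ []
DistinctAbs-applyDescent (there d) (x≢ ∷ rest) =
  All-applyDescent (λ {y} x≢y → x≢y ∘ (λ eq → trans eq (absS-negS y))) d x≢ ∷ DistinctAbs-applyDescent d rest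

private
  headDescent? : ∀ c cs x (xs : List (SFin n)) → ¬ Descent cs xs → Dec (Descent (c ∷ cs) (x ∷ xs))
  headDescent? zero [] (neg i) [] _ = yes negate
  headDescent? zero [] (pos i) [] _ = no λ { (there ()) }
  headDescent? (suc c) [] x [] _ = no λ { (there ()) }
  headDescent? c [] x (y ∷ xs) _ = no λ { (there ()) }
  headDescent? c (c′ ∷ cs) x [] _ = no λ { (there ()) }
  headDescent? c (c′ ∷ cs) x (y ∷ xs) ¬d with c ℕₚ.≟ c′ | y <S? x
  ... | yes refl | yes y<x = yes (swap y<x)
  ... | yes refl | no y≮x = no λ { (swap y<x) → y≮x y<x ; (there d) → ¬d d }
  ... | no c≢c′ | _ = no λ { (swap _) → c≢c′ refl ; (there d) → ¬d d }

descent? : (cs : List ℕ) (xs : List (SFin n)) → Dec (Descent cs xs)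
descent? [] xs = no λ ()
descent? (c ∷ cs) [] = no λ ()
descent? (c ∷ cs) (x ∷ xs) with descent? cs xs
... | yes d = yes (there d)
... | no ¬d = headDescent? c cs x xs ¬d

ℓ : Window n → ℕ
ℓ σ = lengthB (toList σ)

toList-swapAt : {A : Set} {m : ℕ} (k : ℕ) (xs : Vec A m) → toList (swapAt k xs) ≡ swapL k (toList xs)
toList-swapAt zero [] = refl
toList-swapAt zero (x ∷ []) = refl
toList-swapAt zero (x ∷ y ∷ xs) = refl
toList-swapAt (suc k) [] = refl
toList-swapAt (suc k) (x ∷ xs) = cong (x ∷_) (toList-swapAt k xs)

toList-negLast : {m : ℕ} (xs : Vec (SFin n) m) → toList (negLast xs) ≡ negLastL (toList xs)
toList-negLast [] = refl
toList-negLast (x ∷ []) = refl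
toList-negLast (x ∷ y ∷ xs) = cong (x ∷_) (toList-negLast (y ∷ xs))

swapAt-involutive : {A : Set} {m : ℕ} (k : ℕ) (xs : Vec A m) → swapAt k (swapAt k xs) ≡ xs
swapAt-involutive zero [] = refl
swapAt-involutive zero (x ∷ []) = refl
swapAt-involutive zero (x ∷ y ∷ xs) = refl
swapAt-involutive (suc k) [] = refl
swapAt-involutive (suc k) (x ∷ xs) = cong (x ∷_) (swapAt-involutive k xs)

negLast-involutive : {m : ℕ} (xs : Vec (SFin n) m) → negLast (negLast xs) ≡ xs
negLast-involutive [] = refl
negLast-involutive (x ∷ []) = cong (_∷ []) (negS-involutive x)
negLast-involutive (x ∷ y ∷ xs) with negLast (y ∷ xs) | negLast-involutive (y ∷ xs)
... | z ∷ zs | eq = cong (x ∷_) eq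

rmulGen-involutive : (σ : Window n) (k : Fin n) → rmulGen (rmulGen σ k) k ≡ σ
rmulGen-involutive {n} σ k with suc (toℕ k) ℕ.<ᵇ n
... | true = swapAt-involutive (toℕ k) σ
... | false = negLast-involutive σ

rmulGen-cases : (σ : Window n) (k : Fin n) →
  toList (rmulGen σ k) ≡ swapL (toℕ k) (toList σ) ⊎ toList (rmulGen σ k) ≡ negLastL (toList σ)
rmulGen-cases {n} σ k with suc (toℕ k) ℕ.<ᵇ n
... | true = inj₁ (toList-swapAt (toℕ k) σ)
... | false = inj₂ (toList-negLast σ)

rmulGen-swapAt : (σ : Window n) (k : Fin n) → suc (toℕ k) < n → rmulGen σ k ≡ swapAt (toℕ k) σ
rmulGen-swapAt {n} σ k k+1<n with suc (toℕ k) ℕ.<ᵇ n | ℕₚ.<⇒<ᵇ k+1<n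
... | true | _ = refl

rmulGen-last : ∀ {m} (σ : Window (suc m)) → rmulGen σ (fromℕ m) ≡ negLast σ
rmulGen-last {m} σ rewrite Finₚ.toℕ-fromℕ m with m ℕ.<ᵇ m in m<ᵇm
... | false = refl
... | true = ⊥-elim (ℕₚ.<-irrefl refl (ℕₚ.<ᵇ⇒< m m (subst T (sym m<ᵇm) _)))

ℓ-rmulGen≤ : (σ : Window n) (k : Fin n) → ℓ (rmulGen σ k) ≤ ℓ σ + 1
ℓ-rmulGen≤ σ k with rmulGen-cases σ k
... | inj₁ eq rewrite eq = lengthB-swapL≤ (toℕ k) (toList σ)
... | inj₂ eq rewrite eq = lengthB-negLastL≤ (toList σ)

ℓ-foldl≤ : (σ : Window n) (ks : Word n) → ℓ (List.foldl rmulGen σ ks) ≤ ℓ σ + length ks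
ℓ-foldl≤ σ [] = ℕₚ.m≤m+n _ 0
ℓ-foldl≤ σ (k ∷ ks) = begin
  ℓ (List.foldl rmulGen (rmulGen σ k) ks) ≤⟨ ℓ-foldl≤ (rmulGen σ k) ks ⟩
  ℓ (rmulGen σ k) + length ks              ≤⟨ ℕₚ.+-monoˡ-≤ (length ks) (ℓ-rmulGen≤ σ k) ⟩
  ℓ σ + 1 + length ks                      ≡⟨ ℕₚ.+-assoc (ℓ σ) 1 (length ks) ⟩
  ℓ σ + length (k ∷ ks)                    ∎
  where open ℕₚ.≤-Reasoning

descent-generator : (σ : Window n) {cs : List ℕ} (d : Descent cs (toList σ)) →
  ∃ λ k → toList (rmulGen σ k) ≡ applyDescent d
descent-generator {zero} [] ()
descent-generator {suc m} σ d with applyDescent-generator d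
... | inj₁ (j , j+1<len , eq) = k , (begin
  toList (rmulGen σ k)      ≡⟨ cong toList (rmulGen-swapAt σ k (subst (_< suc m) (cong suc (sym toℕk≡j)) j+1<n)) ⟩
  toList (swapAt (toℕ k) σ) ≡⟨ toList-swapAt (toℕ k) σ ⟩
  swapL (toℕ k) (toList σ)  ≡⟨ cong (λ t → swapL t (toList σ)) toℕk≡j ⟩
  swapL j (toList σ)        ≡⟨ eq ⟨
  applyDescent d            ∎)
  where
  open ≡-Reasoning
  j+1<n : suc j < suc m
  j+1<n = subst (suc j <_) (Vecₚ.length-toList σ) j+1<len
  k : Fin (suc m)
  k = fromℕ< (ℕₚ.<-trans (ℕₚ.n<1+n j) j+1<n)
  toℕk≡j : toℕ k ≡ j
  toℕk≡j = Finₚ.toℕ-fromℕ< _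
... | inj₂ eq = fromℕ m , trans (cong toList (rmulGen-last σ)) (trans (toList-negLast σ) (sym eq))

AbsInjective : {m : ℕ} → Vec (SFin n) m → Set
AbsInjective {m = m} σ = (i j : Fin m) → absS (lookup σ i) ≡ absS (lookup σ j) → i ≡ j

absInjective⇒DistinctAbs : {m : ℕ} (σ : Vec (SFin n) m) → AbsInjective σ → DistinctAbs (toList σ)
absInjective⇒DistinctAbs [] _ = []
absInjective⇒DistinctAbs (x ∷ σ) inj =
  VecAllₚ.toList⁺ (VecAllₚ.lookup⁻ λ j eq → 0≢suc (inj Fin.zero (Fin.suc j) eq)) ∷
  absInjective⇒DistinctAbs σ λ i j eq → Finₚ.suc-injective (inj (Fin.suc i) (Fin.suc j) eq)
  where
  0≢suc : ∀ {m} {j : Fin m} → Fin.zero ≢ Fin.suc j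
  0≢suc ()

DistinctAbs⇒absInjective : {m : ℕ} (σ : Vec (SFin n) m) → DistinctAbs (toList σ) → AbsInjective σ
DistinctAbs⇒absInjective (x ∷ σ) (x≢ ∷ _) Fin.zero Fin.zero _ = refl
DistinctAbs⇒absInjective (x ∷ σ) (x≢ ∷ _) Fin.zero (Fin.suc j) eq =
  ⊥-elim (VecAllₚ.lookup⁺ (VecAllₚ.toList⁻ x≢) j eq)
DistinctAbs⇒absInjective (x ∷ σ) (x≢ ∷ _) (Fin.suc i) Fin.zero eq =
  ⊥-elim (VecAllₚ.lookup⁺ (VecAllₚ.toList⁻ x≢) i (sym eq))
DistinctAbs⇒absInjective (x ∷ σ) (_ ∷ distinct) (Fin.suc i) (Fin.suc j) eq =
  cong Fin.suc (DistinctAbs⇒absInjective σ distinct i j eq)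

injective⇒surjective : (f : Fin n → Fin n) → (∀ i j → f i ≡ f j → i ≡ j) → ∀ a → ∃ λ i → f i ≡ a
injective⇒surjective {suc m} f inj a with Finₚ.any? (λ i → f i Finₚ.≟ a)
... | yes hit = hit
... | no miss = ⊥-elim (Finₚ.<⇒notInjective {f = λ i → Fin.punchOut (avoids i)} (ℕₚ.n<1+n m)
                  λ eq → inj _ _ (Finₚ.punchOut-injective (avoids _) (avoids _) eq))
  where
  avoids : ∀ i → a ≢ f i
  avoids i eq = miss (i , sym eq)

Complete : List (SFin n) → Set
Complete {n} xs = (a : Fin n) → Any (λ x → absS x ≡ a) xs

signedPerm-complete : (σ : Window n) → IsSignedPerm σ → Complete (toList σ)
signedPerm-complete σ sp a with injective⇒surjective (λ i → absS (lookup σ i)) sp a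
... | i , eq = Any.map (λ { refl → eq }) (Vec∈ₚ.∈-toList⁺ (Vec∈ₚ.∈-lookup i σ))

-- Reduction modulo the stabiliser of a weight

SendsTo : Vec ℤ n → SFin n → ℕ → Set
SendsTo v x c = lookup v (absS x) ≡ signApply x (ℤ.+ c)

Pointwise-applyDescent : (v : Vec ℤ n) {cs : List ℕ} {xs : List (SFin n)} (d : Descent cs xs) →
  Pointwise (SendsTo v) xs cs → Pointwise (SendsTo v) (applyDescent d) cs
Pointwise-applyDescent v (swap _) (sx ∷ sy ∷ sxs) = sy ∷ sx ∷ sxs
Pointwise-applyDescent v negate (sx ∷ []) = sx ∷ []
Pointwise-applyDescent v (there d) (sx ∷ sxs) = sx ∷ Pointwise-applyDescent v d sxs

record Reduct (v : Vec ℤ n) (cs : List ℕ) (τ : Window n) : Set where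
  field
    window      : Window n
    word        : Word n
    unfolds     : List.foldl rmulGen window word ≡ τ
    shorter     : ℓ window + length word ≤ ℓ τ
    distinct    : DistinctAbs (toList window)
    sends       : Pointwise (SendsTo v) (toList window) cs
    irreducible : ¬ Descent cs (toList window)

reduce : (v : Vec ℤ n) (cs : List ℕ) (τ : Window n) →
  DistinctAbs (toList τ) → Pointwise (SendsTo v) (toList τ) cs → Reduct v cs τ
reduce {n} v cs τ = go τ (<-wellFounded (ℓ τ))
  where
  go : (τ : Window n) → Acc _<_ (ℓ τ) →
    DistinctAbs (toList τ) → Pointwise (SendsTo v) (toList τ) cs → Reduct v cs τ
  go τ (acc smaller) τ-distinct τ-sends with descent? cs (toList τ)
  ... | no irreducible = record
    { window = τ ; word = [] ; unfolds = refl ; shorter = ℕₚ.≤-reflexive (ℕₚ.+-identityʳ (ℓ τ))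
    ; distinct = τ-distinct ; sends = τ-sends ; irreducible = irreducible }
  ... | yes d with descent-generator τ d
  ...   | k , τk≡ = extend (go τk (smaller ℓτk<ℓτ)
            (subst DistinctAbs (sym τk≡) (DistinctAbs-applyDescent d τ-distinct))
            (subst (λ xs → Pointwise (SendsTo v) xs cs) (sym τk≡) (Pointwise-applyDescent v d τ-sends)))
    where
    τk = rmulGen τ k
    ℓτk<ℓτ : ℓ τk < ℓ τ
    ℓτk<ℓτ = subst (λ xs → suc (lengthB xs) ≤ ℓ τ) (sym τk≡) (lengthB-applyDescent d)
    extend : Reduct v cs τk → Reduct v cs τ
    extend r = record
      { window = window
      ; word = word ++ [ k ]
      ; unfolds = trans (Listₚ.foldl-∷ʳ rmulGen window k word)
                        (trans (cong (λ σ → rmulGen σ k) unfolds) (rmulGen-involutive τ k))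
      ; shorter = begin
          ℓ window + length (word ++ [ k ]) ≡⟨ cong (ℓ window +_) (Listₚ.length-++ word) ⟩
          ℓ window + (length word + 1)     ≡⟨ ℕₚ.+-assoc (ℓ window) (length word) 1 ⟨
          ℓ window + length word + 1       ≤⟨ ℕₚ.+-monoˡ-≤ 1 shorter ⟩
          ℓ τk + 1                         ≡⟨ ℕₚ.+-comm (ℓ τk) 1 ⟩
          suc (ℓ τk)                       ≤⟨ ℓτk<ℓτ ⟩
          ℓ τ                              ∎
      ; distinct = distinct
      ; sends = sends
      ; irreducible = irreducible }
      where
      open Reduct r
      open ℕₚ.≤-Reasoning

pointwise-toList⁺ : {A B : Set} {R : A → B → Set} {m : ℕ} (xs : Vec A m) (ys : Vec B m) →
  (∀ i → R (lookup xs i) (lookup ys i)) → Pointwise R (toList xs) (toList ys)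
pointwise-toList⁺ [] [] _ = []
pointwise-toList⁺ (x ∷ xs) (y ∷ ys) r = r Fin.zero ∷ pointwise-toList⁺ xs ys (r ∘ Fin.suc)

pointwise-toList⁻ : {A B : Set} {R : A → B → Set} {m : ℕ} (xs : Vec A m) (ys : Vec B m) →
  Pointwise R (toList xs) (toList ys) → ∀ i → R (lookup xs i) (lookup ys i)
pointwise-toList⁻ (x ∷ xs) (y ∷ ys) (r ∷ _) Fin.zero = r
pointwise-toList⁻ (x ∷ xs) (y ∷ ys) (_ ∷ rs) (Fin.suc i) = pointwise-toList⁻ xs ys rs i

actsTo⇒pointwise : (σ : Window n) (λ′ : Vec ℕ n) (v : Vec ℤ n) →
  ActsTo σ (toℤVec λ′) v → Pointwise (SendsTo v) (toList σ) (toList λ′)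
actsTo⇒pointwise σ λ′ v acts = pointwise-toList⁺ σ λ′ λ i →
  trans (acts i) (cong (signApply (lookup σ i)) (Vecₚ.lookup-map i ℤ.+_ λ′))

pointwise⇒actsTo : (σ : Window n) (λ′ : Vec ℕ n) (v : Vec ℤ n) →
  Pointwise (SendsTo v) (toList σ) (toList λ′) → ActsTo σ (toℤVec λ′) v
pointwise⇒actsTo σ λ′ v sends i =
  trans (pointwise-toList⁻ σ λ′ sends i) (cong (signApply (lookup σ i)) (sym (Vecₚ.lookup-map i ℤ.+_ λ′)))

height : Vec ℤ n → SFin n → ℕ
height v x = ℤ.∣ lookup v (absS x) ∣

withSign : Fin n → ℤ → SFin n
withSign a (ℤ.+ _) = pos a
withSign a -[1+ _ ] = neg a

-- The letters of the reading word of K(v) with the identity column adjoined: x has the sign of v at |x|,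
-- 0 counting as positive.
Canonical : Vec ℤ n → SFin n → Set
Canonical v x = x ≡ withSign (absS x) (lookup v (absS x))

canonical-absS-injective : (v : Vec ℤ n) {x y : SFin n} → Canonical v x → Canonical v y → absS x ≡ absS y → x ≡ y
canonical-absS-injective v x-can y-can eq = trans x-can (trans (cong (λ a → withSign a (lookup v a)) eq) (sym y-can))

sendsTo⇒height : (v : Vec ℤ n) (x : SFin n) (c : ℕ) → SendsTo v x c → height v x ≡ c
sendsTo⇒height v (pos a) c eq = cong ℤ.∣_∣ eq
sendsTo⇒height v (neg a) zero eq = cong ℤ.∣_∣ eq
sendsTo⇒height v (neg a) (suc c) eq = cong ℤ.∣_∣ eq

sendsTo⇒canonical : (v : Vec ℤ n) (x : SFin n) (c : ℕ) → SendsTo v x c → (c ≡ 0 → x ≡ pos (absS x)) → Canonical v x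
sendsTo⇒canonical v (pos a) c eq _ = cong (withSign a) (sym eq)
sendsTo⇒canonical v (neg a) zero eq positive with positive refl
... | ()
sendsTo⇒canonical v (neg a) (suc c) eq _ = cong (withSign a) (sym eq)

ByHeight : (SFin n → ℕ) → SFin n → SFin n → Set
ByHeight h x y = h y < h x ⊎ (h x ≡ h y × x <S y)

ByHeight-trans : (h : SFin n → ℕ) {x y z : SFin n} → ByHeight h x y → ByHeight h y z → ByHeight h x z
ByHeight-trans h (inj₁ p) (inj₁ q) = inj₁ (ℕₚ.<-trans q p)
ByHeight-trans h (inj₁ p) (inj₂ (eq , _)) = inj₁ (subst (_< h _) eq p)
ByHeight-trans h (inj₂ (eq , _)) (inj₁ q) = inj₁ (subst (h _ <_) (sym eq) q)
ByHeight-trans h (inj₂ (eq , p)) (inj₂ (eq′ , q)) = inj₂ (trans eq eq′ , <S-trans p q)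

ByHeight-asym : (h : SFin n → ℕ) → Asymmetric (ByHeight h)
ByHeight-asym h p q with ByHeight-trans h p q
... | inj₁ hx<hx = ℕₚ.<-irrefl refl hx<hx
... | inj₂ (_ , x<x) = <S-irrefl x<x

Decreasing : List ℕ → Set
Decreasing = Linked (λ c d → d ≤ c)

partition-decreasing : {m : ℕ} (λ′ : Vec ℕ m) → IsPartition λ′ → Decreasing (toList λ′)
partition-decreasing [] _ = []
partition-decreasing (_ ∷ []) _ = [-]
partition-decreasing (_ ∷ _ ∷ _) partition =
  partition Fin.zero (Fin.suc Fin.zero) z≤n ∷
  partition-decreasing (_ ∷ _) λ i j i≤j → partition (Fin.suc i) (Fin.suc j) (s≤s i≤j)

irreducible⇒linked : (v : Vec ℤ n) {xs : List (SFin n)} {cs : List ℕ} →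
  DistinctAbs xs → Pointwise (SendsTo v) xs cs → Decreasing cs → ¬ Descent cs xs → Linked (ByHeight (height v)) xs
irreducible⇒linked v _ [] _ _ = []
irreducible⇒linked v _ (_ ∷ []) _ _ = [-]
irreducible⇒linked v {x ∷ y ∷ _} {c ∷ d ∷ _} ((x≢y ∷ _) ∷ distinct) (sx ∷ sy ∷ sys) (d≤c ∷ decreasing) irreducible =
  ordered ∷ irreducible⇒linked v distinct (sy ∷ sys) decreasing (irreducible ∘ there)
  where
  hx≡c = sendsTo⇒height v x c sx
  hy≡d = sendsTo⇒height v y d sy
  ordered : ByHeight (height v) x y
  ordered with ℕₚ.m≤n⇒m<n∨m≡n d≤c
  ... | inj₁ d<c = inj₁ (subst₂ _<_ (sym hy≡d) (sym hx≡c) d<c)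
  ... | inj₂ refl = inj₂ (trans hx≡c (sym hy≡d) , ≯∧≢⇒<S (irreducible ∘ swap) (x≢y ∘ cong absS))

barred-over-zero⇒descent : (v : Vec ℤ n) {i : Fin n} {xs : List (SFin n)} {cs : List ℕ} →
  DistinctAbs (neg i ∷ xs) → Pointwise (SendsTo v) xs cs → Decreasing (0 ∷ cs) → Descent (0 ∷ cs) (neg i ∷ xs)
barred-over-zero⇒descent v _ [] _ = negate
barred-over-zero⇒descent v {i} ((≢y ∷ _) ∷ distinct) (_∷_ {y} _ sys) (z≤n ∷ zeros) with y <S? neg i
... | yes y<x = swap y<x
... | no y≮x with ≯∧≢⇒<S y≮x (≢y ∘ cong absS)
...   | neg<neg _ = there (barred-over-zero⇒descent v distinct sys zeros)

irreducible⇒unbarred-over-zero : (v : Vec ℤ n) {x : SFin n} {xs : List (SFin n)} {cs : List ℕ} →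
  DistinctAbs (x ∷ xs) → Pointwise (SendsTo v) xs cs → Decreasing (0 ∷ cs) → ¬ Descent (0 ∷ cs) (x ∷ xs) →
  x ≡ pos (absS x)
irreducible⇒unbarred-over-zero v {pos _} _ _ _ _ = refl
irreducible⇒unbarred-over-zero v {neg _} distinct sxs decreasing irreducible =
  ⊥-elim (irreducible (barred-over-zero⇒descent v distinct sxs decreasing))

irreducible⇒canonical : (v : Vec ℤ n) {xs : List (SFin n)} {cs : List ℕ} →
  DistinctAbs xs → Pointwise (SendsTo v) xs cs → Decreasing cs → ¬ Descent cs xs → All (Canonical v) xs
irreducible⇒canonical v _ [] _ _ = []
irreducible⇒canonical v {x ∷ _} {c ∷ _} distinct (sx ∷ sxs) decreasing irreducible =
  sendsTo⇒canonical v x c sx (λ { refl → irreducible⇒unbarred-over-zero v distinct sxs decreasing irreducible }) ∷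
  irreducible⇒canonical v (AllPairs.tail distinct) sxs (Linked.tail decreasing) (irreducible ∘ there)

sorted-unique : {A : Set} {R : A → A → Set} → Asymmetric R → {xs ys : List A} →
  AllPairs R xs → AllPairs R ys → (∀ {z} → z ∈ xs → z ∈ ys) → (∀ {z} → z ∈ ys → z ∈ xs) → xs ≡ ys
sorted-unique asym {[]} {[]} _ _ _ _ = refl
sorted-unique asym {[]} {y ∷ ys} _ _ _ ys⊆xs with ys⊆xs (here refl)
... | ()
sorted-unique asym {x ∷ xs} {[]} _ _ xs⊆ys _ with xs⊆ys (here refl)
... | ()
sorted-unique {R = R} asym {x ∷ xs} {y ∷ ys} (x< ∷ xs-sorted) (y< ∷ ys-sorted) xs⊆ys ys⊆xs =
  cong₂ _∷_ x≡y (sorted-unique asym xs-sorted ys-sorted (tail⊆ x< y< x≡y xs⊆ys) (tail⊆ y< x< (sym x≡y) ys⊆xs))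
  where
  x≡y : x ≡ y
  x≡y with xs⊆ys (here refl) | ys⊆xs (here refl)
  ... | here x≡y | _ = x≡y
  ... | there _ | here y≡x = sym y≡x
  ... | there x∈ys | there y∈xs = ⊥-elim (asym (All.lookup x< y∈xs) (All.lookup y< x∈ys))
  tail⊆ : ∀ {x y xs ys} → All (R x) xs → All (R y) ys → x ≡ y →
    (∀ {z} → z ∈ x ∷ xs → z ∈ y ∷ ys) → ∀ {z} → z ∈ xs → z ∈ ys
  tail⊆ x< y< refl ⊆ z∈xs with ⊆ (there z∈xs)
  ... | here refl = ⊥-elim (asym (All.lookup x< z∈xs) (All.lookup x< z∈xs))
  ... | there z∈ys = z∈ys

CanonicalWord : Vec ℤ n → List (SFin n) → Set
CanonicalWord v xs = AllPairs (ByHeight (height v)) xs × All (Canonical v) xs × Complete xs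

canonicalWord-unique : (v : Vec ℤ n) {xs ys : List (SFin n)} → CanonicalWord v xs → CanonicalWord v ys → xs ≡ ys
canonicalWord-unique v (xs-sorted , xs-canonical , xs-complete) (ys-sorted , ys-canonical , ys-complete) =
  sorted-unique (ByHeight-asym (height v)) xs-sorted ys-sorted
    (included xs-canonical ys-canonical ys-complete) (included ys-canonical xs-canonical xs-complete)
  where
  included : ∀ {xs ys} → All (Canonical v) xs → All (Canonical v) ys → Complete ys → ∀ {z} → z ∈ xs → z ∈ ys
  included xs-canonical ys-canonical ys-complete {z} z∈xs with find (ys-complete (absS z))
  ... | y , y∈ys , |y|≡|z| =
    subst (_∈ _) (canonical-absS-injective v (All.lookup ys-canonical y∈ys) (All.lookup xs-canonical z∈xs) |y|≡|z|)
      y∈ys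

reduct-canonicalWord : (v : Vec ℤ n) {cs : List ℕ} {τ : Window n} → Decreasing cs → (r : Reduct v cs τ) →
  CanonicalWord v (toList (Reduct.window r))
reduct-canonicalWord v decreasing r =
  Linkedₚ.Linked⇒AllPairs (ByHeight-trans (height v)) (irreducible⇒linked v distinct sends decreasing irreducible) ,
  irreducible⇒canonical v distinct sends decreasing irreducible ,
  signedPerm-complete window (DistinctAbs⇒absInjective window distinct)
  where open Reduct r

-- Minimal coset representatives

idColumn : (n : ℕ) → List (SFin n)
idColumn n = List.map pos (List.allFin n)

idColumn-sorted : AllPairs _<S_ (idColumn n)
idColumn-sorted = AllPairsₚ.map⁺ (AllPairsₚ.tabulate⁺-< pos<pos)

pos∈idColumn : (a : Fin n) → pos a ∈ idColumn n
pos∈idColumn a = ∈ₚ.∈-map⁺ pos (∈ₚ.∈-allFin a)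

idColumn-unbarred : {y : SFin n} → y ∈ idColumn n → y ≡ pos (absS y)
idColumn-unbarred y∈ with ∈ₚ.∈-map⁻ pos y∈
... | _ , _ , refl = refl

toList-injective : {A : Set} {m : ℕ} {xs ys : Vec A m} → toList xs ≡ toList ys → xs ≡ ys
toList-injective {xs = xs} {ys} eq = trans (sym (Vecₚ.cast-is-id refl xs)) (Vecₚ.toList-injective refl xs ys eq)

toList-tabulate : {A : Set} (f : Fin n → A) → toList (Vec.tabulate f) ≡ List.tabulate f
toList-tabulate {zero} f = refl
toList-tabulate {suc n} f = cong (f Fin.zero ∷_) (toList-tabulate (f ∘ Fin.suc))

toList-idWindow : (n : ℕ) → toList (idWindow n) ≡ idColumn n
toList-idWindow n = trans (Vecₚ.toList-map pos (Vec.allFin n)) (cong (List.map pos) (toList-tabulate (λ i → i)))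

lengthB-ascending : {is : List (Fin n)} → AllPairs Fin._<_ is → lengthB (List.map pos is) ≡ 0
lengthB-ascending [] = refl
lengthB-ascending (i< ∷ ascending) = cong₂ _+_ (cong (_+ 0) (inversions-ascending i<)) (lengthB-ascending ascending)
  where
  inversions-ascending : ∀ {i js} → All (i Fin.<_) js → inversions (pos i) (List.map pos js) ≡ 0
  inversions-ascending [] = refl
  inversions-ascending {i} (_∷_ {j} i<j i<js) =
    cong₂ _+_ (cong₂ _+_ (⟦<S⟧-no (<S-asym (pos<pos i<j))) (⟦<S⟧-no {x = neg j} {pos i} λ ()))
      (inversions-ascending i<js)

ℓ-idWindow : (n : ℕ) → ℓ (idWindow n) ≡ 0
ℓ-idWindow n = trans (cong lengthB (toList-idWindow n))
  (lengthB-ascending (AllPairsₚ.tabulate⁺-< {n = n} {f = λ i → i} (λ i<j → i<j)))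

ℓ-evalWord≤ : (ws : Word n) → ℓ (evalWord ws) ≤ length ws
ℓ-evalWord≤ {n} ws = subst (λ l → ℓ (evalWord ws) ≤ l + length ws) (ℓ-idWindow n) (ℓ-foldl≤ (idWindow n) ws)

zeroWeight : (n : ℕ) → Vec ℤ n
zeroWeight n = Vec.replicate n (ℤ.+ 0)

sendsTo-zeroWeight : {m : ℕ} (xs : Vec (SFin n) m) →
  Pointwise (SendsTo (zeroWeight n)) (toList xs) (List.replicate m 0)
sendsTo-zeroWeight [] = []
sendsTo-zeroWeight {n} (x ∷ xs) = sendsTo-zero x ∷ sendsTo-zeroWeight xs
  where
  sendsTo-zero : (x : SFin n) → SendsTo (zeroWeight n) x 0
  sendsTo-zero (pos a) = Vecₚ.lookup-replicate a (ℤ.+ 0)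
  sendsTo-zero (neg a) = Vecₚ.lookup-replicate a (ℤ.+ 0)

idWindow-canonicalWord : (n : ℕ) → CanonicalWord (zeroWeight n) (toList (idWindow n))
idWindow-canonicalWord n rewrite toList-idWindow n =
  AllPairs.map (λ {x} {y} x<y → inj₂ (trans (height0 x) (sym (height0 y)) , x<y)) idColumn-sorted ,
  All.tabulate (λ y∈ → trans (idColumn-unbarred y∈) (canonical0 _)) ,
  λ a → Any.map (λ { refl → refl }) (pos∈idColumn a)
  where
  height0 : (x : SFin n) → height (zeroWeight n) x ≡ 0
  height0 x = cong ℤ.∣_∣ (Vecₚ.lookup-replicate (absS x) (ℤ.+ 0))
  canonical0 : (a : Fin n) → pos a ≡ withSign a (lookup (zeroWeight n) a)
  canonical0 a = cong (withSign a) (sym (Vecₚ.lookup-replicate a (ℤ.+ 0)))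

word-of-length-ℓ : (σ : Window n) → DistinctAbs (toList σ) → ∃ λ ws → evalWord ws ≡ σ × length ws ≤ ℓ σ
word-of-length-ℓ {n} σ σ-distinct =
  word , subst (λ ρ → List.foldl rmulGen ρ word ≡ σ) window≡id unfolds , ℕₚ.≤-trans (ℕₚ.m≤n+m _ _) shorter
  where
  r = reduce (zeroWeight n) (List.replicate n 0) σ σ-distinct (sendsTo-zeroWeight σ)
  open Reduct r
  window≡id : window ≡ idWindow n
  window≡id = toList-injective
    (canonicalWord-unique (zeroWeight n) (reduct-canonicalWord (zeroWeight n) (zeros n) r) (idWindow-canonicalWord n))
    where
    zeros : ∀ m → Decreasing (List.replicate m 0)
    zeros zero = []
    zeros (suc zero) = [-]
    zeros (suc (suc m)) = z≤n ∷ zeros (suc m)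

reduct-minimal : (v : Vec ℤ n) {cs : List ℕ} {τ₀ : Window n} → Decreasing cs → (r : Reduct v cs τ₀) →
  (τ : Window n) → DistinctAbs (toList τ) → Pointwise (SendsTo v) (toList τ) cs → LengthLE (Reduct.window r) τ
reduct-minimal v {cs} decreasing r τ τ-distinct τ-sends =
  let ws , ws≡σ , |ws|≤ℓσ = word-of-length-ℓ σ distinct in
  ws , ws≡σ , λ w′ w′≡τ → begin
    length ws             ≤⟨ |ws|≤ℓσ ⟩
    ℓ σ                   ≡⟨ cong ℓ σ′≡σ ⟨
    ℓ (Reduct.window r′)  ≤⟨ ℕₚ.m+n≤o⇒m≤o _ (Reduct.shorter r′) ⟩
    ℓ τ                   ≡⟨ cong ℓ w′≡τ ⟨
    ℓ (evalWord w′)       ≤⟨ ℓ-evalWord≤ w′ ⟩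
    length w′             ∎
  where
  open ℕₚ.≤-Reasoning
  open Reduct r renaming (window to σ)
  r′ = reduce v cs τ τ-distinct τ-sends
  σ′≡σ : Reduct.window r′ ≡ σ
  σ′≡σ = toList-injective
    (canonicalWord-unique v (reduct-canonicalWord v decreasing r′) (reduct-canonicalWord v decreasing r))

-- Reading words of key tableaux

module _ {A : Set} {R : A → A → Set} (R? : Decidable R) where

  Fresh : List A → A → Set
  Fresh xs y = ¬ Any (λ x → R x y) xs

  fresh? : (xs : List A) (y : A) → Dec (Fresh xs y)
  fresh? xs y = ¬? (Any.any? (λ x → R? x y) xs)

  filter-fresh-∷ : (x : A) (xs zs : List A) → filter (¬? ∘ R? x) (filter (fresh? xs) zs) ≡ filter (fresh? (x ∷ xs)) zs
  filter-fresh-∷ x xs [] = refl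
  filter-fresh-∷ x xs (z ∷ zs) = by-cases (fresh? xs z) (R? x z)
    where
    open ≡-Reasoning
    by-cases : Dec (Fresh xs z) → Dec (R x z) →
      filter (¬? ∘ R? x) (filter (fresh? xs) (z ∷ zs)) ≡ filter (fresh? (x ∷ xs)) (z ∷ zs)
    by-cases (no stale) _ = begin
      filter (¬? ∘ R? x) (filter (fresh? xs) (z ∷ zs))
        ≡⟨ cong (filter (¬? ∘ R? x)) (Listₚ.filter-reject (fresh? xs) stale) ⟩
      filter (¬? ∘ R? x) (filter (fresh? xs) zs)
        ≡⟨ filter-fresh-∷ x xs zs ⟩
      filter (fresh? (x ∷ xs)) zs
        ≡⟨ Listₚ.filter-reject (fresh? (x ∷ xs)) (λ fresh → stale (fresh ∘ there)) ⟨
      filter (fresh? (x ∷ xs)) (z ∷ zs) ∎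
    by-cases (yes fresh) (yes r) = begin
      filter (¬? ∘ R? x) (filter (fresh? xs) (z ∷ zs))
        ≡⟨ cong (filter (¬? ∘ R? x)) (Listₚ.filter-accept (fresh? xs) fresh) ⟩
      filter (¬? ∘ R? x) (z ∷ filter (fresh? xs) zs)
        ≡⟨ Listₚ.filter-reject (¬? ∘ R? x) (λ ¬r → ¬r r) ⟩
      filter (¬? ∘ R? x) (filter (fresh? xs) zs)
        ≡⟨ filter-fresh-∷ x xs zs ⟩
      filter (fresh? (x ∷ xs)) zs
        ≡⟨ Listₚ.filter-reject (fresh? (x ∷ xs)) (λ fresh′ → fresh′ (here r)) ⟨
      filter (fresh? (x ∷ xs)) (z ∷ zs) ∎
    by-cases (yes fresh) (no ¬r) = begin
      filter (¬? ∘ R? x) (filter (fresh? xs) (z ∷ zs))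
        ≡⟨ cong (filter (¬? ∘ R? x)) (Listₚ.filter-accept (fresh? xs) fresh) ⟩
      filter (¬? ∘ R? x) (z ∷ filter (fresh? xs) zs)
        ≡⟨ Listₚ.filter-accept (¬? ∘ R? x) ¬r ⟩
      z ∷ filter (¬? ∘ R? x) (filter (fresh? xs) zs)
        ≡⟨ cong (z ∷_) (filter-fresh-∷ x xs zs) ⟩
      z ∷ filter (fresh? (x ∷ xs)) zs
        ≡⟨ Listₚ.filter-accept (fresh? (x ∷ xs)) (λ { (here r) → ¬r r ; (there r) → fresh r }) ⟨
      filter (fresh? (x ∷ xs)) (z ∷ zs) ∎

  deduplicate-++ : (xs ys : List A) →
    deduplicate R? (xs ++ ys) ≡ deduplicate R? xs ++ filter (fresh? xs) (deduplicate R? ys)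
  deduplicate-++ [] ys = sym (Listₚ.filter-all (fresh? []) (All.universal (λ _ ()) _))
  deduplicate-++ (x ∷ xs) ys = cong (x ∷_) (begin
    filter (¬? ∘ R? x) (deduplicate R? (xs ++ ys))
      ≡⟨ cong (filter (¬? ∘ R? x)) (deduplicate-++ xs ys) ⟩
    filter (¬? ∘ R? x) (deduplicate R? xs ++ filter (fresh? xs) (deduplicate R? ys))
      ≡⟨ Listₚ.filter-++ (¬? ∘ R? x) (deduplicate R? xs) _ ⟩
    filter (¬? ∘ R? x) (deduplicate R? xs) ++ filter (¬? ∘ R? x) (filter (fresh? xs) (deduplicate R? ys))
      ≡⟨ cong (filter (¬? ∘ R? x) (deduplicate R? xs) ++_) (filter-fresh-∷ x xs (deduplicate R? ys)) ⟩
    filter (¬? ∘ R? x) (deduplicate R? xs) ++ filter (fresh? (x ∷ xs)) (deduplicate R? ys) ∎)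
    where open ≡-Reasoning

  deduplicate-unrelated : {xs : List A} → AllPairs (λ x y → ¬ R x y) xs → deduplicate R? xs ≡ xs
  deduplicate-unrelated [] = refl
  deduplicate-unrelated (x≁ ∷ unrelated) =
    cong (_ ∷_) (trans (cong (filter _) (deduplicate-unrelated unrelated)) (Listₚ.filter-all _ x≁))

concat-reverse-∷ : {A : Set} (xs : List A) (xss : List (List A)) →
  concat (reverse (xs ∷ xss)) ≡ concat (reverse xss) ++ xs
concat-reverse-∷ xs xss = begin
  concat (reverse (xs ∷ xss))      ≡⟨ cong concat (Listₚ.unfold-reverse xs xss) ⟩
  concat (reverse xss ++ [ xs ])   ≡⟨ Listₚ.concat-++ (reverse xss) [ xs ] ⟨
  concat (reverse xss) ++ xs ++ [] ≡⟨ cong (concat (reverse xss) ++_) (Listₚ.++-identityʳ xs) ⟩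
  concat (reverse xss) ++ xs       ∎
  where open ≡-Reasoning

Any-concat-reverse⁻ : {A : Set} {P : A → Set} (xss : List (List A)) → Any P (concat (reverse xss)) → Any P (concat xss)
Any-concat-reverse⁻ xss p = Anyₚ.concat⁺ (Anyₚ.reverse⁻ {xs = xss} (Anyₚ.concat⁻ (reverse xss) p))

Any-concat-reverse⁺ : {A : Set} {P : A → Set} (xss : List (List A)) → Any P (concat xss) → Any P (concat (reverse xss))
Any-concat-reverse⁺ xss p = Anyₚ.concat⁺ {xss = reverse xss} (Anyₚ.reverse⁺ (Anyₚ.concat⁻ xss p))

count-++ : (x : SFin n) (xs ys : List (SFin n)) → count x (xs ++ ys) ≡ count x xs + count x ys
count-++ x xs ys = trans (cong length (Listₚ.filter-++ (x ≟S_) xs ys)) (Listₚ.length-++ (filter (x ≟S_) xs))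

count-∉ : {x : SFin n} {xs : List (SFin n)} → ¬ x ∈ xs → count x xs ≡ 0
count-∉ {x = x} {xs} x∉ = cong length (Listₚ.filter-none (x ≟S_) (Allₚ.¬Any⇒All¬ xs x∉))

count-∈ : {x : SFin n} {xs : List (SFin n)} → x ∈ xs → 1 ≤ count x xs
count-∈ {x = x} = Listₚ.filter-some (x ≟S_)

count-unique : {x : SFin n} {xs : List (SFin n)} → Unique xs → x ∈ xs → count x xs ≡ 1
count-unique {x = x} (y≢ ∷ _) (here refl) =
  trans (cong length (Listₚ.filter-accept (x ≟S_) refl)) (cong suc (count-∉ λ x∈ → All.lookup y≢ x∈ refl))
count-unique {x = x} (y≢ ∷ unique) (there x∈) =
  trans (cong length (Listₚ.filter-reject (x ≟S_) λ { refl → All.lookup y≢ x∈ refl })) (count-unique unique x∈)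

sameAbs? : Decidable (λ (x y : SFin n) → absS x ≡ absS y)
sameAbs? x y = absS x Finₚ.≟ absS y

NoBoth : List (SFin n) → Set
NoBoth {n} E = (i : Fin n) → pos i ∈ E → neg i ∈ E → ⊥

Nested : Column n → Column n → Set
Nested c c′ = ∀ x → x ∈ c′ → x ∈ c

multiplicity : Tableau n → SFin n → ℕ
multiplicity T x = count x (entries T)

<S⇒≢ : {x y : SFin n} → x <S y → x ≢ y
<S⇒≢ x<y refl = <S-irrefl x<y

column-distinctAbs : {E c : List (SFin n)} → NoBoth E → (∀ {x} → x ∈ c → x ∈ E) → AllPairs _<S_ c → DistinctAbs c
column-distinctAbs noBoth c⊆E [] = []
column-distinctAbs {E = E} noBoth c⊆E (x< ∷ sorted) =
  All.tabulate (λ y∈ → distinct (c⊆E (here refl)) (c⊆E (there y∈)) (All.lookup x< y∈)) ∷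
  column-distinctAbs noBoth (c⊆E ∘ there) sorted
  where
  distinct : ∀ {x y} → x ∈ E → y ∈ E → x <S y → absS x ≢ absS y
  distinct {pos i} {pos _} _ _ x<y refl = <S-irrefl x<y
  distinct {neg i} {neg _} _ _ x<y refl = <S-irrefl x<y
  distinct {pos i} {neg _} p∈ n∈ _ refl = noBoth i p∈ n∈
  distinct {neg i} {pos _} n∈ p∈ _ refl = noBoth i p∈ n∈

entries-in-first-column : {c : Column n} {K : Tableau n} → Linked Nested (c ∷ K) → ∀ {x} → x ∈ entries K → x ∈ c
entries-in-first-column {K = c′ ∷ K} (c⊇c′ ∷ nested) x∈ with Anyₚ.++⁻ c′ x∈
... | inj₁ x∈c′ = c⊇c′ _ x∈c′
... | inj₂ x∈K = c⊇c′ _ (entries-in-first-column nested x∈K)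

readingWord⊆entries : (T : Tableau n) → ∀ {x} → x ∈ readingWord T → x ∈ entries T
readingWord⊆entries T x∈ = Any-concat-reverse⁻ T (Anyₚ.deduplicate⁻ sameAbs? x∈)

newLetters : Tableau n → Column n → List (SFin n)
newLetters K c = filter (fresh? sameAbs? (concat (reverse K))) c

newLetters⁻ : (K : Tableau n) (c : Column n) → ∀ {y} → y ∈ newLetters K c →
  y ∈ c × ¬ Any (λ x → absS x ≡ absS y) (entries K)
newLetters⁻ K c y∈ with ∈ₚ.∈-filter⁻ (fresh? sameAbs? (concat (reverse K))) y∈
... | y∈c , fresh = y∈c , fresh ∘ Any-concat-reverse⁺ K

readingWord-∷ : (c : Column n) (K : Tableau n) → DistinctAbs c → readingWord (c ∷ K) ≡ readingWord K ++ newLetters K c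
readingWord-∷ c K distinct = begin
  deduplicate sameAbs? (concat (reverse (c ∷ K)))
    ≡⟨ cong (deduplicate sameAbs?) (concat-reverse-∷ c K) ⟩
  deduplicate sameAbs? (concat (reverse K) ++ c)
    ≡⟨ deduplicate-++ sameAbs? (concat (reverse K)) c ⟩
  readingWord K ++ filter (fresh? sameAbs? (concat (reverse K))) (deduplicate sameAbs? c)
    ≡⟨ cong (λ c′ → readingWord K ++ filter (fresh? sameAbs? (concat (reverse K))) c′)
         (deduplicate-unrelated sameAbs? distinct) ⟩
  readingWord K ++ newLetters K c ∎
  where open ≡-Reasoning

AllPairs-mapWithin : {A : Set} {P : A → Set} {R S : A → A → Set} → (∀ {x y} → P x → P y → R x y → S x y) →
  {xs : List A} → All P xs → AllPairs R xs → AllPairs S xs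
AllPairs-mapWithin f [] [] = []
AllPairs-mapWithin f (px ∷ pxs) (rx ∷ rxs) =
  All.zipWith (λ { (py , r) → f px py r }) (pxs , rx) ∷ AllPairs-mapWithin f pxs rxs

ByHeight-shift : {h h′ : SFin n → ℕ} (k : ℕ) {x y : SFin n} → h′ x ≡ k + h x → h′ y ≡ k + h y →
  ByHeight h x y → ByHeight h′ x y
ByHeight-shift k hx hy (inj₁ p) = inj₁ (subst₂ _<_ (sym hy) (sym hx) (ℕₚ.+-monoʳ-< k p))
ByHeight-shift k hx hy (inj₂ (eq , p)) = inj₂ (trans hx (trans (cong (k +_) eq) (sym hy)) , p)

-- The first column contains one more occurrence of each letter of the later columns, and its new letters
-- occur once.
readingWord-sorted : (K : Tableau n) → All (Linked _<S_) K → Linked Nested K → NoBoth (entries K) →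
  AllPairs (ByHeight (multiplicity K)) (readingWord K)
readingWord-sorted [] _ _ _ = []
readingWord-sorted (c ∷ K) (c-increasing ∷ K-increasing) nested noBoth =
  subst (AllPairs (ByHeight (multiplicity (c ∷ K)))) (sym (readingWord-∷ c K c-distinct))
    (AllPairsₚ.++⁺ old-sorted new-sorted old-before-new)
  where
  c-sorted : AllPairs _<S_ c
  c-sorted = Linkedₚ.Linked⇒AllPairs <S-trans c-increasing
  c-distinct : DistinctAbs c
  c-distinct = column-distinctAbs noBoth Anyₚ.++⁺ˡ c-sorted
  c-unique : Unique c
  c-unique = AllPairs.map <S⇒≢ c-sorted
  old : ∀ {x} → x ∈ readingWord K → multiplicity (c ∷ K) x ≡ 1 + multiplicity K x
  old {x} x∈ = trans (count-++ x c (entries K))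
    (cong (_+ multiplicity K x) (count-unique c-unique (entries-in-first-column nested (readingWord⊆entries K x∈))))
  new : ∀ {y} → y ∈ newLetters K c → multiplicity (c ∷ K) y ≡ 1
  new {y} y∈ with newLetters⁻ K c y∈
  ... | y∈c , y-fresh = trans (count-++ y c (entries K))
    (cong₂ _+_ (count-unique c-unique y∈c) (count-∉ (y-fresh ∘ Any.map (λ { refl → refl }))))
  old-sorted : AllPairs (ByHeight (multiplicity (c ∷ K))) (readingWord K)
  old-sorted = AllPairs-mapWithin (ByHeight-shift 1) (All.tabulate old)
    (readingWord-sorted K K-increasing (Linked.tail nested) λ i p∈ n∈ → noBoth i (Anyₚ.++⁺ʳ c p∈) (Anyₚ.++⁺ʳ c n∈))
  new-sorted : AllPairs (ByHeight (multiplicity (c ∷ K))) (newLetters K c)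
  new-sorted = AllPairs-mapWithin (λ hx hy x<y → inj₂ (trans hx (sym hy) , x<y)) (All.tabulate new)
    (AllPairsₚ.filter⁺ (fresh? sameAbs? (concat (reverse K))) c-sorted)
  old-before-new : All (λ x → All (ByHeight (multiplicity (c ∷ K)) x) (newLetters K c)) (readingWord K)
  old-before-new = All.tabulate λ x∈ → All.tabulate λ y∈ →
    inj₁ (subst₂ _<_ (sym (new y∈)) (sym (old x∈)) (s≤s (count-∈ (readingWord⊆entries K x∈))))

lookup-weight : (T : Tableau n) (a : Fin n) →
  lookup (weight T) a ≡ ℤ.+ count (pos a) (entries T) ℤ.- ℤ.+ count (neg a) (entries T)
lookup-weight T a = Vecₚ.lookup∘tabulate _ a

entry-sendsTo : (T : Tableau n) → NoBoth (entries T) → ∀ {x} → x ∈ entries T → SendsTo (weight T) x (multiplicity T x)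
entry-sendsTo T noBoth {pos a} p∈ = begin
  lookup (weight T) a  ≡⟨ lookup-weight T a ⟩
  ℤ.+ #a ℤ.- ℤ.+ #ā    ≡⟨ cong (λ m → ℤ.+ #a ℤ.- ℤ.+ m) (count-∉ (noBoth a p∈)) ⟩
  ℤ.+ #a ℤ.- ℤ.+ 0     ≡⟨ ℤₚ.+-identityʳ (ℤ.+ #a) ⟩
  ℤ.+ #a               ∎
  where
  open ≡-Reasoning
  #a = count (pos a) (entries T)
  #ā = count (neg a) (entries T)
entry-sendsTo T noBoth {neg a} n∈ = begin
  lookup (weight T) a  ≡⟨ lookup-weight T a ⟩
  ℤ.+ #a ℤ.- ℤ.+ #ā    ≡⟨ cong (λ m → ℤ.+ m ℤ.- ℤ.+ #ā) (count-∉ (λ p∈ → noBoth a p∈ n∈)) ⟩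
  ℤ.+ 0 ℤ.- ℤ.+ #ā     ≡⟨ ℤₚ.+-identityˡ (ℤ.- ℤ.+ #ā) ⟩
  ℤ.- ℤ.+ #ā           ∎
  where
  open ≡-Reasoning
  #a = count (pos a) (entries T)
  #ā = count (neg a) (entries T)

absent-sendsTo : (T : Tableau n) (a : Fin n) → ¬ Any (λ x → absS x ≡ a) (entries T) → SendsTo (weight T) (pos a) 0
absent-sendsTo T a absent = trans (lookup-weight T a)
  (cong₂ (λ p m → ℤ.+ p ℤ.- ℤ.+ m) (count-∉ (absent ∘ Any.map λ { refl → refl }))
                                 (count-∉ (absent ∘ Any.map λ { refl → refl })))

idColumn-distinctAbs : DistinctAbs (idColumn n)
idColumn-distinctAbs = AllPairsₚ.map⁺ (AllPairsₚ.tabulate⁺ (λ i≢j → i≢j))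

adjoinIdColumn-canonicalWord : (K : Tableau n) → IsKeyTableau K →
  CanonicalWord (weight K) (readingWord (adjoinIdColumn K))
adjoinIdColumn-canonicalWord {n} K ((_ , increasing , _) , nested , noBoth) =
  subst (AllPairs (ByHeight (height v))) (sym split) (AllPairsₚ.++⁺ old-sorted new-sorted old-before-new) ,
  subst (All (Canonical v)) (sym split) (Allₚ.++⁺ (All.tabulate old-canonical) (All.tabulate new-canonical)) ,
  complete
  where
  v = weight K
  split : readingWord (adjoinIdColumn K) ≡ readingWord K ++ newLetters K (idColumn n)
  split = readingWord-∷ (idColumn n) K idColumn-distinctAbs
  old : ∀ {x} → x ∈ readingWord K → SendsTo v x (multiplicity K x)
  old x∈ = entry-sendsTo K noBoth (readingWord⊆entries K x∈)
  new : ∀ {y} → y ∈ newLetters K (idColumn n) → SendsTo v y 0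
  new {y} y∈ = subst (λ z → SendsTo v z 0) (sym (idColumn-unbarred (proj₁ y-new)))
                 (absent-sendsTo K (absS y) (proj₂ y-new))
    where y-new = newLetters⁻ K (idColumn n) y∈
  old-height : ∀ {x} → x ∈ readingWord K → height v x ≡ multiplicity K x
  old-height {x} x∈ = sendsTo⇒height v x _ (old x∈)
  new-height : ∀ {y} → y ∈ newLetters K (idColumn n) → height v y ≡ 0
  new-height {y} y∈ = sendsTo⇒height v y 0 (new y∈)
  old-sorted : AllPairs (ByHeight (height v)) (readingWord K)
  old-sorted = AllPairs-mapWithin (ByHeight-shift 0) (All.tabulate old-height)
    (readingWord-sorted K increasing nested noBoth)
  new-sorted : AllPairs (ByHeight (height v)) (newLetters K (idColumn n))
  new-sorted = AllPairs-mapWithin (λ hx hy x<y → inj₂ (trans hx (sym hy) , x<y)) (All.tabulate new-height)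
    (AllPairsₚ.filter⁺ (fresh? sameAbs? (concat (reverse K))) idColumn-sorted)
  old-before-new : All (λ x → All (ByHeight (height v) x) (newLetters K (idColumn n))) (readingWord K)
  old-before-new = All.tabulate λ x∈ → All.tabulate λ y∈ →
    inj₁ (subst₂ _<_ (sym (new-height y∈)) (sym (old-height x∈)) (count-∈ (readingWord⊆entries K x∈)))
  old-canonical : ∀ {x} → x ∈ readingWord K → Canonical v x
  old-canonical {x} x∈ = sendsTo⇒canonical v x _ (old x∈)
    λ m≡0 → ⊥-elim (ℕₚ.<⇒≢ (count-∈ (readingWord⊆entries K x∈)) (sym m≡0))
  new-canonical : ∀ {y} → y ∈ newLetters K (idColumn n) → Canonical v y
  new-canonical {y} y∈ =
    sendsTo⇒canonical v y 0 (new y∈) λ _ → idColumn-unbarred (proj₁ (newLetters⁻ K (idColumn n) y∈))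
  complete : Complete (readingWord (adjoinIdColumn K))
  complete a = Anyₚ.deduplicate⁺ sameAbs? (λ same |x|≡a → trans same |x|≡a)
    (Any-concat-reverse⁺ (adjoinIdColumn K) (Anyₚ.++⁺ˡ (Any.map (λ { refl → refl }) (pos∈idColumn a))))

-- Existence of the key tableau

AllPairs-reverse⁺ : {A : Set} {R : A → A → Set} {xs : List A} → AllPairs R xs → AllPairs (λ x y → R y x) (reverse xs)
AllPairs-reverse⁺ {xs = []} [] = []
AllPairs-reverse⁺ {R = R} {xs = x ∷ xs} (x< ∷ sorted) =
  subst (AllPairs (λ x y → R y x)) (sym (Listₚ.unfold-reverse x xs))
    (AllPairsₚ.++⁺ (AllPairs-reverse⁺ sorted) ([] ∷ []) (All.tabulate λ y∈ → All.lookup x< (Anyₚ.reverse⁻ y∈) ∷ []))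

allLetters : (n : ℕ) → List (SFin n)
allLetters n = idColumn n ++ List.map neg (reverse (List.allFin n))

allLetters-sorted : AllPairs _<S_ (allLetters n)
allLetters-sorted {n} = AllPairsₚ.++⁺ idColumn-sorted
  (AllPairsₚ.map⁺ (AllPairs.map neg<neg
    (AllPairs-reverse⁺ (AllPairsₚ.tabulate⁺-< {n = n} {f = λ i → i} (λ i<j → i<j)))))
  (All.tabulate λ x∈ → All.tabulate λ y∈ → positive-before-barred x∈ y∈)
  where
  positive-before-barred : ∀ {x y} → x ∈ idColumn n → y ∈ List.map neg (reverse (List.allFin n)) → x <S y
  positive-before-barred x∈ y∈ with ∈ₚ.∈-map⁻ pos x∈ | ∈ₚ.∈-map⁻ neg y∈
  ... | _ , _ , refl | _ , _ , refl = pos<neg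

∈-allLetters : (x : SFin n) → x ∈ allLetters n
∈-allLetters (pos a) = Anyₚ.++⁺ˡ (pos∈idColumn a)
∈-allLetters {n} (neg a) = Anyₚ.++⁺ʳ (idColumn n) (∈ₚ.∈-map⁺ neg (Anyₚ.reverse⁺ (∈ₚ.∈-allFin a)))

sublist-rowWeak : {xs ys : List (SFin n)} → AllPairs _<S_ xs → ys ⊆ xs → RowWeak xs ys
sublist-rowWeak {ys = []} _ _ = tt
sublist-rowWeak {ys = y ∷ ys} (_ ∷ sorted) (refl ∷ ys⊆xs) = inj₂ refl , sublist-rowWeak sorted ys⊆xs
sublist-rowWeak {ys = y ∷ ys} (x< ∷ sorted) (_ ∷ʳ y∷ys⊆xs) =
  inj₁ (All.lookup x< (to∈ y∷ys⊆xs)) , sublist-rowWeak sorted (⊆-trans (y ∷ʳ ⊆-refl) y∷ys⊆xs)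

∈⇒≤sum : {m : ℕ} {ms : List ℕ} → m ∈ ms → m ≤ sum ms
∈⇒≤sum {ms = m ∷ ms} (here refl) = ℕₚ.m≤m+n m (sum ms)
∈⇒≤sum {ms = m′ ∷ ms} (there m∈) = ℕₚ.≤-trans (∈⇒≤sum m∈) (ℕₚ.m≤n+m (sum ms) m′)

NonEmpty? : {A : Set} (xs : List A) → Dec (NonEmpty xs)
NonEmpty? [] = no λ ()
NonEmpty? (_ ∷ _) = yes tt

concat-filter-NonEmpty : {A : Set} (xss : List (List A)) → concat (filter NonEmpty? xss) ≡ concat xss
concat-filter-NonEmpty [] = refl
concat-filter-NonEmpty ([] ∷ xss) = concat-filter-NonEmpty xss
concat-filter-NonEmpty ((x ∷ xs) ∷ xss) = cong ((x ∷ xs) ++_) (concat-filter-NonEmpty xss)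

module KeyTableau (v : Vec ℤ n) where

  InColumn : ℕ → SFin n → Set
  InColumn k x = Canonical v x × k ≤ height v x

  inColumn? : (k : ℕ) (x : SFin n) → Dec (InColumn k x)
  inColumn? k x = (x ≟S withSign (absS x) (lookup v (absS x))) ×-dec (k ℕₚ.≤? height v x)

  column : ℕ → Column n
  column k = filter (inColumn? k) (allLetters n)

  column-sorted : (k : ℕ) → AllPairs _<S_ (column k)
  column-sorted k = AllPairsₚ.filter⁺ (inColumn? k) allLetters-sorted

  ∈-column⁻ : ∀ {k x} → x ∈ column k → InColumn k x
  ∈-column⁻ {k} x∈ = proj₂ (∈ₚ.∈-filter⁻ (inColumn? k) {xs = allLetters n} x∈)

  ∈-column⁺ : ∀ {k x} → InColumn k x → x ∈ column k
  ∈-column⁺ {k} {x} = ∈ₚ.∈-filter⁺ (inColumn? k) (∈-allLetters x)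

  column-antitone : ∀ {j k} → j ≤ k → Nested (column j) (column k) × RowWeak (column j) (column k)
  column-antitone {j} {k} j≤k =
    (λ x x∈ → ∈-column⁺ (weaken (∈-column⁻ x∈))) ,
    sublist-rowWeak (column-sorted j)
      (Sublistₚ.filter⁺ (inColumn? k) (inColumn? j) (λ { refl → weaken }) (⊆-refl {x = allLetters n}))
    where
    weaken : ∀ {x} → InColumn k x → InColumn j x
    weaken (canonical , k≤h) = canonical , ℕₚ.≤-trans j≤k k≤h

  column-unique : (k : ℕ) → Unique (column k)
  column-unique k = AllPairs.map <S⇒≢ (column-sorted k)

  columns : ℕ → ℕ → List (Column n)
  columns k zero = []
  columns k (suc m) = column k ∷ columns (suc k) m

  columns-index : ∀ k m → All (λ c → ∃ λ j → k ≤ j × c ≡ column j) (columns k m)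
  columns-index k zero = []
  columns-index k (suc m) = (k , ℕₚ.≤-refl , refl) ∷
    All.map (λ { (j , k<j , refl) → j , ℕₚ.<⇒≤ k<j , refl }) (columns-index (suc k) m)

  columns-antitone : ∀ k m → AllPairs (λ c c′ → Nested c c′ × RowWeak c c′) (columns k m)
  columns-antitone k zero = []
  columns-antitone k (suc m) =
    All.map (λ { (j , k<j , refl) → column-antitone (ℕₚ.<⇒≤ k<j) }) (columns-index (suc k) m) ∷
    columns-antitone (suc k) m

  columns-canonical : ∀ k m {x} → x ∈ concat (columns k m) → Canonical v x
  columns-canonical k (suc m) x∈ with Anyₚ.++⁻ (column k) x∈
  ... | inj₁ x∈c = proj₁ (∈-column⁻ x∈c)
  ... | inj₂ x∈cs = columns-canonical (suc k) m x∈cs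

  count-columns : ∀ {x} → Canonical v x → ∀ k m → height v x < k + m →
    count x (concat (columns k m)) ≡ suc (height v x) ∸ k
  count-columns x-can k zero h<k = sym (ℕₚ.m≤n⇒m∸n≡0 (subst (_ <_) (ℕₚ.+-identityʳ k) h<k))
  count-columns {x} x-can k (suc m) h<k+m+1 = begin
    count x (column k ++ concat (columns (suc k) m))
      ≡⟨ count-++ x (column k) (concat (columns (suc k) m)) ⟩
    count x (column k) + count x (concat (columns (suc k) m))
      ≡⟨ cong (count x (column k) +_) (count-columns x-can (suc k) m (subst (height v x <_) (ℕₚ.+-suc k m) h<k+m+1)) ⟩
    count x (column k) + (height v x ∸ k)
      ≡⟨ by-cases (k ℕₚ.≤? height v x) ⟩
    suc (height v x) ∸ k ∎
    where
    open ≡-Reasoning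
    by-cases : Dec (k ≤ height v x) → count x (column k) + (height v x ∸ k) ≡ suc (height v x) ∸ k
    by-cases (yes k≤h) = trans (cong (_+ (height v x ∸ k)) (count-unique (column-unique k) (∈-column⁺ (x-can , k≤h))))
                               (sym (ℕₚ.+-∸-assoc 1 k≤h))
    by-cases (no k≰h) = begin
      count x (column k) + (height v x ∸ k)
        ≡⟨ cong₂ _+_ (count-∉ (k≰h ∘ proj₂ ∘ ∈-column⁻)) (ℕₚ.m≤n⇒m∸n≡0 (ℕₚ.<⇒≤ h<k)) ⟩
      0
        ≡⟨ ℕₚ.m≤n⇒m∸n≡0 h<k ⟨
      suc (height v x) ∸ k ∎
      where h<k = ℕₚ.≰⇒> k≰h

  heightBound : ℕ
  heightBound = sum (List.map (height v) (allLetters n))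

  tableau : Tableau n
  tableau = filter NonEmpty? (columns 1 heightBound)

  entries-tableau : entries tableau ≡ concat (columns 1 heightBound)
  entries-tableau = concat-filter-NonEmpty (columns 1 heightBound)

  count-tableau : ∀ {x} → Canonical v x → count x (entries tableau) ≡ height v x
  count-tableau {x} x-can = trans (cong (count x) entries-tableau)
    (count-columns x-can 1 heightBound (s≤s (∈⇒≤sum (∈ₚ.∈-map⁺ (height v) (∈-allLetters x)))))

  count-tableau-noncanonical : ∀ {x} → ¬ Canonical v x → count x (entries tableau) ≡ 0
  count-tableau-noncanonical x-noncan =
    count-∉ (x-noncan ∘ columns-canonical 1 heightBound ∘ subst (_ ∈_) entries-tableau)

  weight-tableau : weight tableau ≡ v
  weight-tableau = trans (Vecₚ.tabulate-cong lookup-eq) (Vecₚ.tabulate∘lookup v)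
    where
    lookup-eq : ∀ a → ℤ.+ count (pos a) (entries tableau) ℤ.- ℤ.+ count (neg a) (entries tableau) ≡ lookup v a
    lookup-eq a with lookup v a in va
    ... | ℤ.+ c
      rewrite count-tableau {pos a} (cong (withSign a) (sym va))
            | count-tableau-noncanonical {neg a} (λ can → case trans can (cong (withSign a) va) of λ ())
            | va = ℤₚ.+-identityʳ (ℤ.+ c)
    ... | -[1+ c ]
      rewrite count-tableau {neg a} (cong (withSign a) (sym va))
            | count-tableau-noncanonical {pos a} (λ can → case trans can (cong (withSign a) va) of λ ())
            | va = ℤₚ.+-identityˡ -[1+ c ]

  tableau-isKey : IsKeyTableau tableau
  tableau-isKey =
    (Allₚ.all-filter NonEmpty? (columns 1 heightBound) ,
     Allₚ.filter⁺ NonEmpty?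
       (All.map (λ { (j , _ , refl) → Linkedₚ.AllPairs⇒Linked (column-sorted j) }) (columns-index 1 heightBound)) ,
     Linked.map proj₂ antitone) ,
    Linked.map proj₁ antitone ,
    noBoth
    where
    antitone : Linked (λ c c′ → Nested c c′ × RowWeak c c′) tableau
    antitone = Linkedₚ.AllPairs⇒Linked (AllPairsₚ.filter⁺ NonEmpty? (columns-antitone 1 heightBound))
    canonical : ∀ {x} → x ∈ entries tableau → Canonical v x
    canonical = columns-canonical 1 heightBound ∘ subst (_ ∈_) entries-tableau
    noBoth : NoBoth (entries tableau)
    noBoth i p∈ n∈ with canonical-absS-injective v (canonical p∈) (canonical n∈) refl
    ... | ()

proposition2p23 : ∀ (n : ℕ) (λ' : Vec ℕ n) (v : Vec ℤ n) →
    IsPartition λ' → InOrbit v λ' →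
    -- K(v) exists ...
    Σ (Tableau n) (λ K → IsKeyTableau K × weight K ≡ v) ×
    -- ... and (it being unique) for the key tableau K of weight v:
    (∀ (K : Tableau n) → IsKeyTableau K → weight K ≡ v →
      Σ (Window n) λ σ →
        toList σ ≡ readingWord (adjoinIdColumn K) ×
        IsSignedPerm σ × ActsTo σ (toℤVec λ') v ×
        (∀ (τ : Window n) → IsSignedPerm τ → ActsTo τ (toℤVec λ') v → LengthLE σ τ))
proposition2p23 n λ' v partition (τ₀ , τ₀-signed , τ₀-acts) =
  (tableau , tableau-isKey , weight-tableau) ,
  λ K K-key K-weight →
    σ ,
    canonicalWord-unique v (reduct-canonicalWord v decreasing r)
      (subst (λ w → CanonicalWord w (readingWord (adjoinIdColumn K))) K-weight (adjoinIdColumn-canonicalWord K K-key)) ,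
    DistinctAbs⇒absInjective σ distinct ,
    pointwise⇒actsTo σ λ' v sends ,
    λ τ τ-signed τ-acts →
      reduct-minimal v decreasing r τ (absInjective⇒DistinctAbs τ τ-signed) (actsTo⇒pointwise τ λ' v τ-acts)
  where
  open KeyTableau v
  decreasing = partition-decreasing λ' partition
  r = reduce v (toList λ') τ₀ (absInjective⇒DistinctAbs τ₀ τ₀-signed) (actsTo⇒pointwise τ₀ λ' v τ₀-acts)
  open Reduct r renaming (window to σ)
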